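{- For integers $i,j\ge0$, let $\mathcal{C}_{i,j}$ be the set of partitions $\lambda$ with exactly $i+2j$ parts such that (1) each part occurs at most twice, (2) exactly $j$ distinct part sizes occur twice, and (3) any two distinct part sizes occurring in $\lambda$ differ by at least $2$. Then $$\sum_{\lambda\in\mathcal{C}_{i,j}}v^{\ell_r(\lambda)}u^{\ell_d(\lambda)}q^{|\lambda|}=\frac{v^ju^{i+j}q^{i^2+2ij+2j^2}}{(q;q)_i(q^2;q^2)_j}.$$
   Context: $(a;q)_n=(1-a)(1-aq)\cdots(1-aq^{n-1})$, $(a;q)_0=1$. For a partition $\lambda$, $|\lambda|$ is the sum of its parts, $\ell_d(\lambda)$ is the number of distinct part sizes occurring in $\lambda$, and $\ell_r(\lambda)$ is the number of part sizes occurring more than once in $\lambda$. -}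

module Defs where

open import Level using (Level)
open import Data.Nat using (ℕ; zero; suc; _+_; _*_; _∸_; _≤_; _≤?_; _≟_)
open import Data.Nat.Divisibility using (_∣?_)
open import Data.List using (List; []; _∷_; _++_; map; concatMap; upTo; filter; length; deduplicate; replicate; foldr)
open import Data.List.Relation.Unary.All using (All; all?)
open import Data.Product using (_×_)
open import Data.Sum using (_⊎_)
open import Relation.Nullary using (Dec; yes; no; does)
open import Relation.Nullary.Decidable using (_×-dec_; _⊎-dec_)
open import Relation.Binary.PropositionalEquality using (_≡_)
open import Data.Bool using (if_then_else_)
open import Algebra.Bundles using (CommutativeSemiring)

-- A partition is a list of positive parts in non-increasing order.
-- partitionsLE n m : all partitions of n whose parts are all ≤ m
-- (each listed exactly once): choose the multiplicity k of the part m,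
-- then recurse on parts ≤ m - 1.
partitionsLE : ℕ → ℕ → List (List ℕ)
partitionsLE zero    zero    = [] ∷ []
partitionsLE (suc _) zero    = []
partitionsLE n       (suc m) =
  concatMap (λ k → map (replicate k (suc m) ++_) (partitionsLE (n ∸ k * suc m) m))
            (filter (λ k → k * suc m ≤? n) (upTo (suc n)))

partitions : ℕ → List (List ℕ)
partitions n = partitionsLE n n

mult : ℕ → List ℕ → ℕ
mult a λs = length (filter (a ≟_) λs)

ℓd : List ℕ → ℕ
ℓd λs = length (deduplicate _≟_ λs)

ℓr : List ℕ → ℕ
ℓr λs = length (filter (λ a → 2 ≤? mult a λs) (deduplicate _≟_ λs))

InC : ℕ → ℕ → List ℕ → Set
InC i j λs =
  (length λs ≡ i + 2 * j)
  × All (λ a → mult a λs ≤ 2) λs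
  × (ℓr λs ≡ j)
  × All (λ a → All (λ b → (a ≡ b) ⊎ ((a + 2 ≤ b) ⊎ (b + 2 ≤ a))) λs) λs

InC? : ∀ i j λs → Dec (InC i j λs)
InC? i j λs =
  (length λs ≟ i + 2 * j)
  ×-dec (all? (λ a → mult a λs ≤? 2) λs
  ×-dec ((ℓr λs ≟ j)
  ×-dec all? (λ a → all? (λ b → (a ≟ b) ⊎-dec ((a + 2 ≤? b) ⊎-dec (b + 2 ≤? a))) λs) λs))

module Series {c ℓ : Level} (R : CommutativeSemiring c ℓ) where
  open CommutativeSemiring R using (Carrier; 0#; 1#) renaming (_+_ to _+R_; _*_ to _*R_)

  -- formal power series in q over R, as coefficient sequences
  PS : Set c
  PS = ℕ → Carrier

  pow : Carrier → ℕ → Carrier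
  pow x zero    = 1#
  pow x (suc n) = x *R pow x n

  sumR : List Carrier → Carrier
  sumR = foldr _+R_ 0#

  _⊛_ : PS → PS → PS
  (f ⊛ g) n = sumR (map (λ k → f k *R g (n ∸ k)) (upTo (suc n)))

  shift : ℕ → PS → PS
  shift N F n = if does (N ≤? n) then F (n ∸ N) else 0#

  -- 1/(1 - q^k) = Σ_{m ≥ 0} q^{k m}   (used for k ≥ 1)
  geom : ℕ → PS
  geom k n = if does (k ∣? n) then 1# else 0#

  one : PS
  one zero    = 1#
  one (suc _) = 0#

  invQ : ℕ → PS
  invQ zero    = one
  invQ (suc i) = invQ i ⊛ geom (suc i)

  invQ2 : ℕ → PS
  invQ2 zero    = one
  invQ2 (suc j) = invQ2 j ⊛ geom (2 * suc j)

  genC : ℕ → ℕ → Carrier → Carrier → PS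
  genC i j u v n = sumR (map (λ λs → pow v (ℓr λs) *R pow u (ℓd λs)) (filter (InC? i j) (partitions n)))

  rhsC : ℕ → ℕ → Carrier → Carrier → PS
  rhsC i j u v n = (pow v j *R pow u (i + j)) *R shift (i * i + 2 * i * j + 2 * j * j) (invQ i ⊛ invQ2 j) n

{-# OPTIONS --safe #-}
-- Write N_m(i,j) for the generating function of the partitions in C_{i,j} whose parts are at most m.
-- Splitting off the copies (none, one or two) of the largest part m gives the "top" recursion
--   N_m(i,j) = N_{m-1}(i,j) + q^m N_{m-2}(i-1,j) + q^{2m} N_{m-2}(i,j-1).
-- By induction on m this yields the "bottom" recursion, which removes the parts equal to 1 and
-- lowers all other parts:
--   N_m(i,j) = q^{i+2j} N_{m-1}(i,j) + q^{2i+4j-1} N_{m-2}(i-1,j) + q^{2i+4j-2} N_{m-2}(i,j-1).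
-- Since (1 - q^k)/(q;q)_k = 1/(q;q)_{k-1}, the right-hand side G(i,j) satisfies the same recursion
-- with m = ∞. For (i,j) ≠ (0,0) all three shifts are positive, so the recursion determines the
-- coefficient of q^n from smaller ones, and N_m and G agree in all degrees ≤ m. Finally the weight
-- v^{ℓr} u^{ℓd} is constant on C_{i,j}: when every part occurs at most twice, the number of parts
-- is ℓd + ℓr, so ℓd = i + j.
module Submission where

open import Defs
open import Level using (Level)
open import Data.Nat
  using (ℕ; zero; suc; _+_; _*_; _∸_; _≤_; _<_; _≤?_; _<?_; _≤ᵇ_; _≟_; z≤n; s≤s; NonZero; >-nonZero⁻¹)
open import Data.Nat.Properties
open import Data.Nat.Induction using (<-rec)
open import Data.Nat.Divisibility using (_∣_; _∣?_; _∣0; ∣m+n∣m⇒∣n; ∣m∸n∣n⇒∣m; ∣⇒≤; ∣-refl)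
open import Data.Nat.ListAction.Properties using (sum-++)
open import Data.Nat.Tactic.RingSolver using (solve-∀)
open import Data.Bool using (true; false; if_then_else_)
open import Data.Empty using (⊥-elim)
open import Data.Product using (_×_; _,_; proj₁; proj₂)
open import Data.Sum using (_⊎_; inj₁; inj₂)
open import Data.List
  using (List; []; _∷_; _++_; [_]; _∷ʳ_; map; concatMap; upTo; filter; length; replicate; deduplicate)
open import Data.List.Properties
  using ( map-cong; map-++; map-applyUpTo; upTo-∷ʳ; filter-++; length-++; length-filter
        ; filter-none; filter-all; filter-accept; filter-reject; filter-idem )
open import Data.List.Relation.Unary.All as All using (All; []; _∷_; all?)
open import Data.List.Relation.Unary.All.Properties
  using (deduplicate⁺; ++⁺; replicate⁺; concat⁺; map⁺; all-filter; filter⁺)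
open import Function using (_∘_; id)
open import Function.Bundles using (_⇔_; mk⇔; Equivalence)
open import Relation.Nullary using (¬_; does; yes; no; ¬?)
open import Relation.Nullary.Decidable using (dec-true; dec-false; does-⇔; _×-dec_)
open import Relation.Unary using (Decidable)
open import Relation.Binary.PropositionalEquality
  using (_≡_; _≢_; _≗_; refl; sym; trans; cong; cong₂; subst; module ≡-Reasoning)
open import Algebra.Bundles using (CommutativeSemiring)

open Series +-*-commutativeSemiring using (PS; sumR; _⊛_; shift; geom; one; invQ; invQ2)

-- Power series over ℕ

infixl 6 _+ₛ_

_+ₛ_ : PS → PS → PS
(F +ₛ G) n = F n + G n

0ₛ : PS
0ₛ _ = 0

shift-≤ : ∀ N F {n} → N ≤ n → shift N F n ≡ F (n ∸ N)
shift-≤ N F {n} N≤n with N ≤ᵇ n | ≤⇒≤ᵇ N≤n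
... | true | _ = refl

shift-< : ∀ N F {n} → n < N → shift N F n ≡ 0
shift-< N F {n} n<N with N ≤ᵇ n | ≤ᵇ⇒≤ N n
... | false | _   = refl
... | true  | N≤n = ⊥-elim (<⇒≱ n<N (N≤n _))

shift-cong-at : ∀ N F G n → (N ≤ n → F (n ∸ N) ≡ G (n ∸ N)) → shift N F n ≡ shift N G n
shift-cong-at N F G n eq with N ≤? n
... | yes N≤n = trans (shift-≤ N F N≤n) (trans (eq N≤n) (sym (shift-≤ N G N≤n)))
... | no N≰n  = trans (shift-< N F (≰⇒> N≰n)) (sym (shift-< N G (≰⇒> N≰n)))

shift-cong : ∀ N {F G} → F ≗ G → shift N F ≗ shift N G
shift-cong N {F} {G} F≗G n = shift-cong-at N F G n (λ _ → F≗G _)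

shift-zero : ∀ N → shift N 0ₛ ≗ 0ₛ
shift-zero N n with N ≤ᵇ n
... | true  = refl
... | false = refl

shift-+ : ∀ N F G → shift N (F +ₛ G) ≗ shift N F +ₛ shift N G
shift-+ N F G n with N ≤ᵇ n
... | true  = refl
... | false = refl

shift-suc : ∀ N F k → shift (suc N) F (suc k) ≡ shift N F k
shift-suc zero    F k = refl
shift-suc (suc N) F k = refl

shift-shift : ∀ a b F → shift a (shift b F) ≗ shift (a + b) F
shift-shift zero    b F n       = refl
shift-shift (suc a) b F zero    = refl
shift-shift (suc a) b F (suc n) =
  trans (shift-suc a (shift b F) n) (trans (shift-shift a b F n) (sym (shift-suc (a + b) F n)))

shift²-≡ : ∀ a b c d F → a + b ≡ c + d → shift a (shift b F) ≗ shift c (shift d F)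
shift²-≡ a b c d F eq n =
  trans (shift-shift a b F n) (trans (cong (λ t → shift t F n) eq) (sym (shift-shift c d F n)))

sum-map-+ : ∀ {A : Set} (f g : A → ℕ) xs →
            sumR (map (λ x → f x + g x) xs) ≡ sumR (map f xs) + sumR (map g xs)
sum-map-+ f g []       = refl
sum-map-+ f g (x ∷ xs) =
  trans (cong (f x + g x +_) (sum-map-+ f g xs)) (+-interchange (f x) (g x) _ _)
  where open import Algebra.Properties.CommutativeSemigroup +-commutativeSemigroup
          using () renaming (interchange to +-interchange)

⊛-cong : ∀ {f f′ g g′} → f ≗ f′ → g ≗ g′ → f ⊛ g ≗ f′ ⊛ g′
⊛-cong f≗f′ g≗g′ n = cong sumR (map-cong (λ k → cong₂ _*_ (f≗f′ k) (g≗g′ (n ∸ k))) (upTo (suc n)))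

⊛-distribˡ : ∀ f g h → f ⊛ (g +ₛ h) ≗ (f ⊛ g) +ₛ (f ⊛ h)
⊛-distribˡ f g h n = trans
  (cong sumR (map-cong (λ k → *-distribˡ-+ (f k) (g (n ∸ k)) (h (n ∸ k))) (upTo (suc n))))
  (sum-map-+ (λ k → f k * g (n ∸ k)) (λ k → f k * h (n ∸ k)) (upTo (suc n)))

⊛-distribʳ : ∀ f g h → (f +ₛ g) ⊛ h ≗ (f ⊛ h) +ₛ (g ⊛ h)
⊛-distribʳ f g h n = trans
  (cong sumR (map-cong (λ k → *-distribʳ-+ (h (n ∸ k)) (f k) (g k)) (upTo (suc n))))
  (sum-map-+ (λ k → f k * h (n ∸ k)) (λ k → g k * h (n ∸ k)) (upTo (suc n)))

⊛-suc : ∀ f g n → (f ⊛ g) (suc n) ≡ f 0 * g (suc n) + ((f ∘ suc) ⊛ g) n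
⊛-suc f g n = cong (f 0 * g (suc n) +_) (cong sumR
  (trans (map-applyUpTo suc term (suc n)) (sym (map-applyUpTo id (term ∘ suc) (suc n)))))
  where term = λ k → f k * g (suc n ∸ k)

⊛-identityʳ : ∀ f → f ⊛ one ≗ f
⊛-identityʳ f zero    = trans (+-identityʳ _) (*-identityʳ (f 0))
⊛-identityʳ f (suc n) =
  trans (⊛-suc f one n) (cong₂ _+_ (*-zeroʳ (f 0)) (⊛-identityʳ (f ∘ suc) n))

shift-⊛ : ∀ N f g → shift N f ⊛ g ≗ shift N (f ⊛ g)
shift-⊛ zero    f g n       = refl
shift-⊛ (suc N) f g zero    = refl
shift-⊛ (suc N) f g (suc n) = begin
  (shift (suc N) f ⊛ g) (suc n)    ≡⟨ ⊛-suc (shift (suc N) f) g n ⟩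
  ((shift (suc N) f ∘ suc) ⊛ g) n  ≡⟨ ⊛-cong {g = g} (shift-suc N f) (λ _ → refl) n ⟩
  (shift N f ⊛ g) n                ≡⟨ shift-⊛ N f g n ⟩
  shift N (f ⊛ g) n                ≡⟨ shift-suc N (f ⊛ g) n ⟨
  shift (suc N) (f ⊛ g) (suc n)    ∎
  where open ≡-Reasoning

⊛-shift₁ : ∀ f g → f ⊛ shift 1 g ≗ shift 1 (f ⊛ g)
⊛-shift₁ f g zero    = cong (_+ 0) (*-zeroʳ (f 0))
⊛-shift₁ f g (suc n) =
  trans (⊛-suc f (shift 1 g) n) (trans (cong (f 0 * g n +_) (⊛-shift₁ (f ∘ suc) g n)) (head n))
  where
  head : ∀ n → f 0 * g n + shift 1 ((f ∘ suc) ⊛ g) n ≡ (f ⊛ g) n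
  head zero    = refl
  head (suc m) = sym (⊛-suc f g m)

⊛-shift : ∀ N f g → f ⊛ shift N g ≗ shift N (f ⊛ g)
⊛-shift zero    f g n = refl
⊛-shift (suc N) f g n = begin
  (f ⊛ shift (suc N) g) n      ≡⟨ ⊛-cong {f = f} (λ _ → refl) (λ k → sym (shift-shift 1 N g k)) n ⟩
  (f ⊛ shift 1 (shift N g)) n  ≡⟨ ⊛-shift₁ f (shift N g) n ⟩
  shift 1 (f ⊛ shift N g) n    ≡⟨ shift-cong 1 (⊛-shift N f g) n ⟩
  shift 1 (shift N (f ⊛ g)) n  ≡⟨ shift-shift 1 N (f ⊛ g) n ⟩
  shift (suc N) (f ⊛ g) n      ∎
  where open ≡-Reasoning

geom-step : ∀ k {n} → k ≤ n → geom k n ≡ geom k (n ∸ k)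
geom-step k {n} k≤n = cong (λ b → if b then 1 else 0) (does-⇔ (mk⇔ to from) (k ∣? n) (k ∣? (n ∸ k)))
  where
  to : k ∣ n → k ∣ n ∸ k
  to k∣n = ∣m+n∣m⇒∣n (subst (k ∣_) (sym (m+[n∸m]≡n k≤n)) k∣n) ∣-refl
  from : k ∣ n ∸ k → k ∣ n
  from k∣n∸k = ∣m∸n∣n⇒∣m k k≤n k∣n∸k ∣-refl

geom-rec : ∀ k .{{_ : NonZero k}} → geom k ≗ one +ₛ shift k (geom k)
geom-rec k zero rewrite dec-true (k ∣? 0) (k ∣0) = sym (cong suc (shift-< k (geom k) (>-nonZero⁻¹ k)))
geom-rec k (suc n) with k ≤? suc n
... | yes k≤n = trans (geom-step k k≤n) (sym (shift-≤ k (geom k) k≤n))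
... | no k≰n rewrite dec-false (k ∣? suc n) (k≰n ∘ ∣⇒≤) = sym (shift-< k (geom k) (≰⇒> k≰n))

⊛-geom : ∀ F k .{{_ : NonZero k}} → F ⊛ geom k ≗ F +ₛ shift k (F ⊛ geom k)
⊛-geom F k n = begin
  (F ⊛ geom k) n                          ≡⟨ ⊛-cong {f = F} (λ _ → refl) (geom-rec k) n ⟩
  (F ⊛ (one +ₛ shift k (geom k))) n       ≡⟨ ⊛-distribˡ F one (shift k (geom k)) n ⟩
  (F ⊛ one) n + (F ⊛ shift k (geom k)) n  ≡⟨ cong₂ _+_ (⊛-identityʳ F n) (⊛-shift k F (geom k) n) ⟩
  F n + shift k (F ⊛ geom k) n            ∎
  where open ≡-Reasoning

-- Families of series indexed by (i, j)

Family : Set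
Family = ℕ → ℕ → PS

Weight : Set
Weight = ℕ → ℕ → ℕ

infixl 6 _⊕_
infix  4 _≋_

_⊕_ : Family → Family → Family
(X ⊕ Y) i j = X i j +ₛ Y i j

_≋_ : Family → Family → Set
X ≋ Y = ∀ i j → X i j ≗ Y i j

≋-sym : ∀ {X Y} → X ≋ Y → Y ≋ X
≋-sym X≋Y i j n = sym (X≋Y i j n)

≋-trans : ∀ {X Y Z} → X ≋ Y → Y ≋ Z → X ≋ Z
≋-trans X≋Y Y≋Z i j n = trans (X≋Y i j n) (Y≋Z i j n)

+₃-cong : ∀ {a a′ b b′ c c′ : ℕ} → a ≡ a′ → b ≡ b′ → c ≡ c′ → a + b + c ≡ a′ + b′ + c′
+₃-cong refl refl refl = refl

⊕₃-cong : ∀ {X X′ Y Y′ Z Z′} → X ≋ X′ → Y ≋ Y′ → Z ≋ Z′ → X ⊕ Y ⊕ Z ≋ X′ ⊕ Y′ ⊕ Z′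
⊕₃-cong X≋X′ Y≋Y′ Z≋Z′ i j n = +₃-cong (X≋X′ i j n) (Y≋Y′ i j n) (Z≋Z′ i j n)

𝟘 : Family
𝟘 _ _ = 0ₛ

δ : Family
δ zero    zero    = one
δ zero    (suc _) = 0ₛ
δ (suc _) _       = 0ₛ

shiftBy : Weight → Family → Family
shiftBy w X i j = shift (w i j) (X i j)

-- lowerᵢ w X at (i + 1, j) is X i j shifted by w i j: weights are evaluated at the lowered index.
lowerᵢ : Weight → Family → Family
lowerᵢ w X zero    j = 0ₛ
lowerᵢ w X (suc i) j = shift (w i j) (X i j)

lowerⱼ : Weight → Family → Family
lowerⱼ w X i zero    = 0ₛ
lowerⱼ w X i (suc j) = shift (w i j) (X i j)

Additive : (Family → Family) → Set
Additive T = ∀ X Y → T (X ⊕ Y) ≋ T X ⊕ T Y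

Congruent : (Family → Family) → Set
Congruent T = ∀ {X Y} → X ≋ Y → T X ≋ T Y

additive₃ : ∀ T → Additive T → ∀ X Y Z → T (X ⊕ Y ⊕ Z) ≋ T X ⊕ T Y ⊕ T Z
additive₃ T add X Y Z i j n = trans (add (X ⊕ Y) Z i j n) (cong (_+ T Z i j n) (add X Y i j n))

shiftBy-additive : ∀ w → Additive (shiftBy w)
shiftBy-additive w X Y i j = shift-+ (w i j) (X i j) (Y i j)

lowerᵢ-additive : ∀ w → Additive (lowerᵢ w)
lowerᵢ-additive w X Y zero    j n = refl
lowerᵢ-additive w X Y (suc i) j   = shift-+ (w i j) (X i j) (Y i j)

lowerⱼ-additive : ∀ w → Additive (lowerⱼ w)
lowerⱼ-additive w X Y i zero    n = refl
lowerⱼ-additive w X Y i (suc j)   = shift-+ (w i j) (X i j) (Y i j)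

shiftBy-cong : ∀ w → Congruent (shiftBy w)
shiftBy-cong w X≋Y i j = shift-cong (w i j) (X≋Y i j)

lowerᵢ-cong : ∀ w → Congruent (lowerᵢ w)
lowerᵢ-cong w X≋Y zero    j n = refl
lowerᵢ-cong w X≋Y (suc i) j   = shift-cong (w i j) (X≋Y i j)

lowerⱼ-cong : ∀ w → Congruent (lowerⱼ w)
lowerⱼ-cong w X≋Y i zero    n = refl
lowerⱼ-cong w X≋Y i (suc j)   = shift-cong (w i j) (X≋Y i j)

lowerᵢ-𝟘 : ∀ w → lowerᵢ w 𝟘 ≋ 𝟘
lowerᵢ-𝟘 w zero    j n = refl
lowerᵢ-𝟘 w (suc i) j   = shift-zero (w i j)

lowerⱼ-𝟘 : ∀ w → lowerⱼ w 𝟘 ≋ 𝟘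
lowerⱼ-𝟘 w i zero    n = refl
lowerⱼ-𝟘 w i (suc j)   = shift-zero (w i j)

module _ (w₁ w₂ w₃ w₄ : Weight) (X : Family) where

  shiftBy-shiftBy : (∀ i j → w₁ i j + w₂ i j ≡ w₃ i j + w₄ i j) →
                    shiftBy w₁ (shiftBy w₂ X) ≋ shiftBy w₃ (shiftBy w₄ X)
  shiftBy-shiftBy eq i j = shift²-≡ (w₁ i j) (w₂ i j) (w₃ i j) (w₄ i j) (X i j) (eq i j)

  lowerᵢ-shiftBy : (∀ i j → w₁ i j + w₂ i j ≡ w₃ (suc i) j + w₄ i j) →
                   lowerᵢ w₁ (shiftBy w₂ X) ≋ shiftBy w₃ (lowerᵢ w₄ X)
  lowerᵢ-shiftBy eq zero    j n = sym (shift-zero (w₃ 0 j) n)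
  lowerᵢ-shiftBy eq (suc i) j   =
    shift²-≡ (w₁ i j) (w₂ i j) (w₃ (suc i) j) (w₄ i j) (X i j) (eq i j)

  lowerⱼ-shiftBy : (∀ i j → w₁ i j + w₂ i j ≡ w₃ i (suc j) + w₄ i j) →
                   lowerⱼ w₁ (shiftBy w₂ X) ≋ shiftBy w₃ (lowerⱼ w₄ X)
  lowerⱼ-shiftBy eq i zero    n = sym (shift-zero (w₃ i 0) n)
  lowerⱼ-shiftBy eq i (suc j)   =
    shift²-≡ (w₁ i j) (w₂ i j) (w₃ i (suc j)) (w₄ i j) (X i j) (eq i j)

  lowerᵢ-lowerᵢ : (∀ i j → w₁ (suc i) j + w₂ i j ≡ w₃ (suc i) j + w₄ i j) →
                  lowerᵢ w₁ (lowerᵢ w₂ X) ≋ lowerᵢ w₃ (lowerᵢ w₄ X)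
  lowerᵢ-lowerᵢ eq zero          j n = refl
  lowerᵢ-lowerᵢ eq (suc zero)    j n = trans (shift-zero (w₁ 0 j) n) (sym (shift-zero (w₃ 0 j) n))
  lowerᵢ-lowerᵢ eq (suc (suc i)) j   =
    shift²-≡ (w₁ (suc i) j) (w₂ i j) (w₃ (suc i) j) (w₄ i j) (X i j) (eq i j)

  lowerⱼ-lowerⱼ : (∀ i j → w₁ i (suc j) + w₂ i j ≡ w₃ i (suc j) + w₄ i j) →
                  lowerⱼ w₁ (lowerⱼ w₂ X) ≋ lowerⱼ w₃ (lowerⱼ w₄ X)
  lowerⱼ-lowerⱼ eq i zero          n = refl
  lowerⱼ-lowerⱼ eq i (suc zero)    n = trans (shift-zero (w₁ i 0) n) (sym (shift-zero (w₃ i 0) n))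
  lowerⱼ-lowerⱼ eq i (suc (suc j))   =
    shift²-≡ (w₁ i (suc j)) (w₂ i j) (w₃ i (suc j)) (w₄ i j) (X i j) (eq i j)

  lowerᵢ-lowerⱼ : (∀ i j → w₁ i (suc j) + w₂ i j ≡ w₃ (suc i) j + w₄ i j) →
                  lowerᵢ w₁ (lowerⱼ w₂ X) ≋ lowerⱼ w₃ (lowerᵢ w₄ X)
  lowerᵢ-lowerⱼ eq zero    zero    n = refl
  lowerᵢ-lowerⱼ eq zero    (suc j) n = sym (shift-zero (w₃ 0 j) n)
  lowerᵢ-lowerⱼ eq (suc i) zero    n = shift-zero (w₁ i 0) n
  lowerᵢ-lowerⱼ eq (suc i) (suc j)   =
    shift²-≡ (w₁ i (suc j)) (w₂ i j) (w₃ (suc i) j) (w₄ i j) (X i j) (eq i j)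

-- The top and bottom recursions

addSingle : ℕ → Family → Family
addSingle k = lowerᵢ (λ _ _ → k)

addPair : ℕ → Family → Family
addPair k = lowerⱼ (λ _ _ → 2 * k)

-- bounded (2 + m) counts the partitions in C_{i,j} with parts ≤ m (see count-bounded);
-- bounded 1 = δ and bounded 0 = 𝟘 play the roles of m = -1 and m = -2, so that the
-- recursion already holds for m = 0.
bounded : ℕ → Family
bounded zero          = 𝟘
bounded (suc zero)    = δ
bounded (suc (suc m)) = bounded (suc m) ⊕ addSingle m (bounded m) ⊕ addPair m (bounded m)

#parts : Weight
#parts i j = i + 2 * j

-- A partition in C_{i,j} has #parts i j parts. If 1 is not a part, lower every part by 1;
-- if 1 occurs once (twice), delete it (them) and lower the other parts by 2.
singleOne : Weight
singleOne i j = 2 * #parts i j + 1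

pairOfOnes : Weight
pairOfOnes i j = 2 * #parts i j + 2

bottomStep : Family → Family → Family
bottomStep Y Z = shiftBy #parts Y ⊕ lowerᵢ singleOne Z ⊕ lowerⱼ pairOfOnes Z

bottomStep-⊕ : ∀ Y Y′ Z Z′ → bottomStep (Y ⊕ Y′) (Z ⊕ Z′) ≋ bottomStep Y Z ⊕ bottomStep Y′ Z′
bottomStep-⊕ Y Y′ Z Z′ i j n = trans
  (⊕₃-cong (shiftBy-additive #parts Y Y′) (lowerᵢ-additive singleOne Z Z′)
           (lowerⱼ-additive pairOfOnes Z Z′) i j n)
  (regroup (A Y) (A Y′) (B Z) (B Z′) (C Z) (C Z′))
  where
  A = λ X → shiftBy #parts X i j n
  B = λ X → lowerᵢ singleOne X i j n
  C = λ X → lowerⱼ pairOfOnes X i j n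
  regroup : ∀ a a′ b b′ c c′ → (a + a′) + (b + b′) + (c + c′) ≡ (a + b + c) + (a′ + b′ + c′)
  regroup = solve-∀

addSingle-bottomStep : ∀ k Y Z →
  addSingle (2 + k) (bottomStep Y Z) ≋ bottomStep (addSingle (1 + k) Y) (addSingle k Z)
addSingle-bottomStep k Y Z i j n = trans
  (additive₃ (addSingle (2 + k)) (lowerᵢ-additive (λ _ _ → 2 + k))
             (shiftBy #parts Y) (lowerᵢ singleOne Z) (lowerⱼ pairOfOnes Z) i j n)
  (⊕₃-cong raised single pair i j n)
  where
  raised : addSingle (2 + k) (shiftBy #parts Y) ≋ shiftBy #parts (addSingle (1 + k) Y)
  raised = lowerᵢ-shiftBy (λ _ _ → 2 + k) #parts #parts (λ _ _ → 1 + k) Y (weights k)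
    where weights : ∀ k i j → 2 + k + (i + 2 * j) ≡ suc i + 2 * j + (1 + k)
          weights = solve-∀
  single : addSingle (2 + k) (lowerᵢ singleOne Z) ≋ lowerᵢ singleOne (addSingle k Z)
  single = lowerᵢ-lowerᵢ (λ _ _ → 2 + k) singleOne singleOne (λ _ _ → k) Z (weights k)
    where weights : ∀ k i j → 2 + k + (2 * (i + 2 * j) + 1) ≡ 2 * (suc i + 2 * j) + 1 + k
          weights = solve-∀
  pair : addSingle (2 + k) (lowerⱼ pairOfOnes Z) ≋ lowerⱼ pairOfOnes (addSingle k Z)
  pair = lowerᵢ-lowerⱼ (λ _ _ → 2 + k) pairOfOnes pairOfOnes (λ _ _ → k) Z (weights k)
    where weights : ∀ k i j → 2 + k + (2 * (i + 2 * j) + 2) ≡ 2 * (suc i + 2 * j) + 2 + k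
          weights = solve-∀

addPair-bottomStep : ∀ k Y Z →
  addPair (2 + k) (bottomStep Y Z) ≋ bottomStep (addPair (1 + k) Y) (addPair k Z)
addPair-bottomStep k Y Z i j n = trans
  (additive₃ (addPair (2 + k)) (lowerⱼ-additive (λ _ _ → 2 * (2 + k)))
             (shiftBy #parts Y) (lowerᵢ singleOne Z) (lowerⱼ pairOfOnes Z) i j n)
  (⊕₃-cong raised single pair i j n)
  where
  raised : addPair (2 + k) (shiftBy #parts Y) ≋ shiftBy #parts (addPair (1 + k) Y)
  raised = lowerⱼ-shiftBy (λ _ _ → 2 * (2 + k)) #parts #parts (λ _ _ → 2 * (1 + k)) Y (weights k)
    where weights : ∀ k i j → 2 * (2 + k) + (i + 2 * j) ≡ i + 2 * suc j + 2 * (1 + k)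
          weights = solve-∀
  single : addPair (2 + k) (lowerᵢ singleOne Z) ≋ lowerᵢ singleOne (addPair k Z)
  single =
    ≋-sym (lowerᵢ-lowerⱼ singleOne (λ _ _ → 2 * k) (λ _ _ → 2 * (2 + k)) singleOne Z (weights k))
    where weights : ∀ k i j → 2 * (i + 2 * suc j) + 1 + 2 * k ≡ 2 * (2 + k) + (2 * (i + 2 * j) + 1)
          weights = solve-∀
  pair : addPair (2 + k) (lowerⱼ pairOfOnes Z) ≋ lowerⱼ pairOfOnes (addPair k Z)
  pair = lowerⱼ-lowerⱼ (λ _ _ → 2 * (2 + k)) pairOfOnes pairOfOnes (λ _ _ → 2 * k) Z (weights k)
    where weights : ∀ k i j → 2 * (2 + k) + (2 * (i + 2 * j) + 2) ≡ 2 * (i + 2 * suc j) + 2 + 2 * k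
          weights = solve-∀

shiftBy-δ : shiftBy #parts δ ≋ δ
shiftBy-δ zero    zero    n = refl
shiftBy-δ zero    (suc j)   = shift-zero (#parts 0 (suc j))
shiftBy-δ (suc i) j         = shift-zero (#parts (suc i) j)

lowerᵢ-δ : ∀ w w′ → w 0 0 ≡ w′ 0 0 → lowerᵢ w δ ≋ lowerᵢ w′ δ
lowerᵢ-δ w w′ eq zero          j       n = refl
lowerᵢ-δ w w′ eq (suc zero)    zero    n = cong (λ N → shift N one n) eq
lowerᵢ-δ w w′ eq (suc zero)    (suc j) n =
  trans (shift-zero (w 0 (suc j)) n) (sym (shift-zero (w′ 0 (suc j)) n))
lowerᵢ-δ w w′ eq (suc (suc i)) j       n =
  trans (shift-zero (w (suc i) j) n) (sym (shift-zero (w′ (suc i) j) n))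

lowerⱼ-δ : ∀ w w′ → w 0 0 ≡ w′ 0 0 → lowerⱼ w δ ≋ lowerⱼ w′ δ
lowerⱼ-δ w w′ eq i       zero          n = refl
lowerⱼ-δ w w′ eq zero    (suc zero)    n = cong (λ N → shift N one n) eq
lowerⱼ-δ w w′ eq (suc i) (suc zero)    n =
  trans (shift-zero (w (suc i) 0) n) (sym (shift-zero (w′ (suc i) 0) n))
lowerⱼ-δ w w′ eq zero    (suc (suc j)) n =
  trans (shift-zero (w 0 (suc j)) n) (sym (shift-zero (w′ 0 (suc j)) n))
lowerⱼ-δ w w′ eq (suc i) (suc (suc j)) n =
  trans (shift-zero (w (suc i) (suc j)) n) (sym (shift-zero (w′ (suc i) (suc j)) n))

bounded-2 : bounded 2 ≋ δ
bounded-2 zero    zero    n = trans (+-identityʳ _) (+-identityʳ _)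
bounded-2 zero    (suc j) n = refl
bounded-2 (suc i) zero    n = refl
bounded-2 (suc i) (suc j) n = refl

-- The inductive step only uses that adding a largest part commutes with bottomStep.
bounded-bottomStep : ∀ k → bounded (2 + k) ≋ bottomStep (bounded (1 + k)) (bounded k)
bounded-bottomStep zero = ⊕₃-cong (≋-sym shiftBy-δ)
  (≋-trans (lowerᵢ-𝟘 (λ _ _ → 0)) (≋-sym (lowerᵢ-𝟘 singleOne)))
  (≋-trans (lowerⱼ-𝟘 (λ _ _ → 0)) (≋-sym (lowerⱼ-𝟘 pairOfOnes)))
bounded-bottomStep (suc zero) = ⊕₃-cong
  (≋-trans bounded-2 (≋-trans (≋-sym shiftBy-δ) (shiftBy-cong #parts (≋-sym bounded-2))))
  (lowerᵢ-δ (λ _ _ → 1) singleOne refl)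
  (lowerⱼ-δ (λ _ _ → 2) pairOfOnes refl)
bounded-bottomStep (suc (suc k)) i j n = begin
  (V₃ ⊕ addSingle (2 + k) V₂ ⊕ addPair (2 + k) V₂) i j n
    ≡⟨ ⊕₃-cong (bounded-bottomStep (suc k)) (lowerᵢ-cong _ (bounded-bottomStep k))
               (lowerⱼ-cong _ (bounded-bottomStep k)) i j n ⟩
  (bottomStep V₂ V₁ ⊕ addSingle (2 + k) (bottomStep V₁ V₀) ⊕ addPair (2 + k) (bottomStep V₁ V₀)) i j n
    ≡⟨ +₃-cong refl (addSingle-bottomStep k V₁ V₀ i j n) (addPair-bottomStep k V₁ V₀ i j n) ⟩
  (bottomStep V₂ V₁ ⊕ bottomStep S₁ S₀ ⊕ bottomStep P₁ P₀) i j n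
    ≡⟨ cong (_+ bottomStep P₁ P₀ i j n) (bottomStep-⊕ V₂ S₁ V₁ S₀ i j n) ⟨
  (bottomStep (V₂ ⊕ S₁) (V₁ ⊕ S₀) ⊕ bottomStep P₁ P₀) i j n
    ≡⟨ bottomStep-⊕ (V₂ ⊕ S₁) P₁ (V₁ ⊕ S₀) P₀ i j n ⟨
  bottomStep (V₂ ⊕ S₁ ⊕ P₁) (V₁ ⊕ S₀ ⊕ P₀) i j n ∎
  where
  open ≡-Reasoning
  V₀ = bounded k
  V₁ = bounded (1 + k)
  V₂ = bounded (2 + k)
  V₃ = bounded (3 + k)
  S₀ = addSingle k V₀
  S₁ = addSingle (1 + k) V₁
  P₀ = addPair k V₀
  P₁ = addPair (1 + k) V₁

-- The right-hand side

invPoch : Family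
invPoch i j = invQ i ⊛ invQ2 j

invPoch-sucᵢ : ∀ i j → invPoch (suc i) j ≗ invPoch i j +ₛ shift (suc i) (invPoch (suc i) j)
invPoch-sucᵢ i j n = begin
  ((invQ i ⊛ geom (suc i)) ⊛ invQ2 j) n
    ≡⟨ ⊛-cong {g = invQ2 j} (⊛-geom (invQ i) (suc i)) (λ _ → refl) n ⟩
  ((invQ i +ₛ shift (suc i) (invQ (suc i))) ⊛ invQ2 j) n
    ≡⟨ ⊛-distribʳ (invQ i) (shift (suc i) (invQ (suc i))) (invQ2 j) n ⟩
  invPoch i j n + (shift (suc i) (invQ (suc i)) ⊛ invQ2 j) n
    ≡⟨ cong (invPoch i j n +_) (shift-⊛ (suc i) (invQ (suc i)) (invQ2 j) n) ⟩
  invPoch i j n + shift (suc i) (invPoch (suc i) j) n ∎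
  where open ≡-Reasoning

invPoch-sucⱼ : ∀ i j → invPoch i (suc j) ≗ invPoch i j +ₛ shift (2 * suc j) (invPoch i (suc j))
invPoch-sucⱼ i j n = begin
  (invQ i ⊛ (invQ2 j ⊛ geom (2 * suc j))) n
    ≡⟨ ⊛-cong {f = invQ i} (λ _ → refl) (⊛-geom (invQ2 j) (2 * suc j)) n ⟩
  (invQ i ⊛ (invQ2 j +ₛ shift (2 * suc j) (invQ2 (suc j)))) n
    ≡⟨ ⊛-distribˡ (invQ i) (invQ2 j) (shift (2 * suc j) (invQ2 (suc j))) n ⟩
  invPoch i j n + (invQ i ⊛ shift (2 * suc j) (invQ2 (suc j))) n
    ≡⟨ cong (invPoch i j n +_) (⊛-shift (2 * suc j) (invQ i) (invQ2 (suc j)) n) ⟩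
  invPoch i j n + shift (2 * suc j) (invPoch i (suc j)) n ∎
  where open ≡-Reasoning

invPoch-rec : invPoch ≋ shiftBy #parts invPoch ⊕ lowerᵢ (λ _ j → 2 * j) invPoch
                                                ⊕ lowerⱼ (λ _ _ → 0) invPoch
invPoch-rec zero    zero    n = sym (trans (+-identityʳ _) (+-identityʳ _))
invPoch-rec (suc i) zero    n = begin
  invPoch I 0 n                                      ≡⟨ invPoch-sucᵢ i 0 n ⟩
  invPoch i 0 n + raised                             ≡⟨ +-comm (invPoch i 0 n) raised ⟩
  raised + invPoch i 0 n
    ≡⟨ cong (λ N → shift N (invPoch I 0) n + invPoch i 0 n) (+-identityʳ I) ⟨
  shift (I + 0) (invPoch I 0) n + invPoch i 0 n      ≡⟨ +-identityʳ _ ⟨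
  shift (I + 0) (invPoch I 0) n + invPoch i 0 n + 0  ∎
  where
  open ≡-Reasoning
  I = suc i
  raised = shift I (invPoch I 0) n
invPoch-rec zero    (suc j) n = begin
  invPoch 0 J n               ≡⟨ invPoch-sucⱼ 0 j n ⟩
  invPoch 0 j n + raised      ≡⟨ +-comm (invPoch 0 j n) raised ⟩
  raised + invPoch 0 j n      ≡⟨ cong (_+ invPoch 0 j n) (+-identityʳ raised) ⟨
  raised + 0 + invPoch 0 j n  ∎
  where
  open ≡-Reasoning
  J = suc j
  raised = shift (2 * J) (invPoch 0 J) n
invPoch-rec (suc i) (suc j) n = begin
  invPoch I J n
    ≡⟨ invPoch-sucⱼ I j n ⟩
  invPoch I j n + shift (2 * J) (invPoch I J) n
    ≡⟨ cong (invPoch I j n +_) (shift-cong (2 * J) (invPoch-sucᵢ i J) n) ⟩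
  invPoch I j n + shift (2 * J) (invPoch i J +ₛ shift I (invPoch I J)) n
    ≡⟨ cong (invPoch I j n +_) (shift-+ (2 * J) (invPoch i J) (shift I (invPoch I J)) n) ⟩
  invPoch I j n + (shift (2 * J) (invPoch i J) n + shift (2 * J) (shift I (invPoch I J)) n)
    ≡⟨ cong (λ t → invPoch I j n + (shift (2 * J) (invPoch i J) n + t))
            (shift²-≡ (2 * J) I (I + 2 * J) 0 (invPoch I J)
                      (trans (+-comm (2 * J) I) (sym (+-identityʳ _))) n) ⟩
  invPoch I j n + (shift (2 * J) (invPoch i J) n + shift (I + 2 * J) (invPoch I J) n)
    ≡⟨ rotate (invPoch I j n) (shift (2 * J) (invPoch i J) n) (shift (I + 2 * J) (invPoch I J) n) ⟩
  shift (I + 2 * J) (invPoch I J) n + shift (2 * J) (invPoch i J) n + invPoch I j n ∎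
  where
  open ≡-Reasoning
  I = suc i
  J = suc j
  rotate : ∀ a b c → a + (b + c) ≡ c + b + a
  rotate = solve-∀

-- Size of the smallest partition in C_{i,j}: 1, 1, 3, 3, …, 2j-1, 2j-1, 2j+1, 2j+3, …, 2j+2i-1
minSize : Weight
minSize i j = i * i + 2 * i * j + 2 * j * j

rhs : Family
rhs = shiftBy minSize invPoch

rhs-bottomStep : rhs ≋ bottomStep rhs rhs
rhs-bottomStep = ≋-trans (shiftBy-cong minSize invPoch-rec) (≋-trans
  (additive₃ (shiftBy minSize) (shiftBy-additive minSize)
             (shiftBy #parts invPoch) (lowerᵢ (λ _ j → 2 * j) invPoch) (lowerⱼ (λ _ _ → 0) invPoch))
  (⊕₃-cong (shiftBy-shiftBy minSize #parts #parts minSize invPoch λ i j → +-comm (minSize i j) (#parts i j))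
           (≋-sym (lowerᵢ-shiftBy singleOne minSize minSize (λ _ j → 2 * j) invPoch single))
           (≋-sym (lowerⱼ-shiftBy pairOfOnes minSize minSize (λ _ _ → 0) invPoch pair))))
  where
  single : ∀ i j → 2 * (i + 2 * j) + 1 + (i * i + 2 * i * j + 2 * j * j)
                 ≡ suc i * suc i + 2 * suc i * j + 2 * j * j + 2 * j
  single = solve-∀
  pair : ∀ i j → 2 * (i + 2 * j) + 2 + (i * i + 2 * i * j + 2 * j * j)
               ≡ i * i + 2 * i * suc j + 2 * suc j * suc j + 0
  pair = solve-∀

rhs-00 : rhs 0 0 ≗ one
rhs-00 = ⊛-identityʳ one

bounded-00 : ∀ k → 1 ≤ k → bounded k 0 0 ≗ one
bounded-00 (suc zero)    _ n = refl
bounded-00 (suc (suc k)) _ n =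
  trans (+-identityʳ (bounded (suc k) 0 0 n + 0)) (trans (+-identityʳ _) (bounded-00 (suc k) (s≤s z≤n) n))

-- The inductive step of bounded≡rhs for (i, j) ≠ (0, 0), where all shifts in bottomStep are positive.
module Agreement {n} (IH : ∀ {m} → m < n → ∀ k → 2 + m ≤ k → ∀ i j → bounded k i j m ≡ rhs i j m)
                 {k} (n≤k : n ≤ k) where

  shift-agrees : ∀ {k′} w i j → 1 ≤ w → (w ≤ n → 2 + (n ∸ w) ≤ k′) →
                 shift w (bounded k′ i j) n ≡ shift w (rhs i j) n
  shift-agrees {k′} w i j 1≤w bound = shift-cong-at w (bounded k′ i j) (rhs i j) n
    (λ w≤n → IH (∸-monoʳ-< 1≤w w≤n) k′ (bound w≤n) i j)

  shift≥2-agrees : ∀ w i j → 2 ≤ w → shift w (bounded k i j) n ≡ shift w (rhs i j) n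
  shift≥2-agrees w i j 2≤w = shift-agrees w i j (≤-trans (s≤s z≤n) 2≤w) λ w≤n →
    ≤-trans (≤-trans (+-monoˡ-≤ (n ∸ w) 2≤w) (≤-reflexive (m+[n∸m]≡n w≤n))) n≤k

  2≤singleOne : ∀ i j → 1 ≤ #parts i j → 2 ≤ singleOne i j
  2≤singleOne i j p = ≤-trans (*-monoʳ-≤ 2 p) (m≤m+n _ 1)

  raise-agrees : ∀ i j → 1 ≤ #parts i j →
                 shiftBy #parts (bounded (suc k)) i j n ≡ shiftBy #parts rhs i j n
  raise-agrees i j p = shift-agrees (#parts i j) i j p (λ w≤n → s≤s (≤-trans (∸-monoʳ-< p w≤n) n≤k))

  -- At (1, 0) the shift is only 1; there bounded k 0 0 = one already holds for every k ≥ 1.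
  singleOne-agrees : ∀ i j → lowerᵢ singleOne (bounded k) i j n ≡ lowerᵢ singleOne rhs i j n
  singleOne-agrees zero          j       = refl
  singleOne-agrees (suc zero)    zero    = shift-cong-at 1 (bounded k 0 0) (rhs 0 0) n λ 1≤n →
    trans (bounded-00 k (≤-trans 1≤n n≤k) (n ∸ 1)) (sym (rhs-00 (n ∸ 1)))
  singleOne-agrees (suc zero)    (suc j) =
    shift≥2-agrees (singleOne 0 (suc j)) 0 (suc j) (2≤singleOne 0 (suc j) (s≤s z≤n))
  singleOne-agrees (suc (suc i)) j       =
    shift≥2-agrees (singleOne (suc i) j) (suc i) j (2≤singleOne (suc i) j (s≤s z≤n))

  pairOfOnes-agrees : ∀ i j → lowerⱼ pairOfOnes (bounded k) i j n ≡ lowerⱼ pairOfOnes rhs i j n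
  pairOfOnes-agrees i zero    = refl
  pairOfOnes-agrees i (suc j) = shift≥2-agrees (pairOfOnes i j) i j (m≤n+m 2 _)

  agrees : ∀ i j → 1 ≤ #parts i j → bounded (2 + k) i j n ≡ rhs i j n
  agrees i j p = begin
    bounded (2 + k) i j n
      ≡⟨ bounded-bottomStep k i j n ⟩
    bottomStep (bounded (1 + k)) (bounded k) i j n
      ≡⟨ +₃-cong (raise-agrees i j p) (singleOne-agrees i j) (pairOfOnes-agrees i j) ⟩
    bottomStep rhs rhs i j n
      ≡⟨ rhs-bottomStep i j n ⟨
    rhs i j n                                       ∎
    where open ≡-Reasoning

bounded≡rhs : ∀ n k → 2 + n ≤ k → ∀ i j → bounded k i j n ≡ rhs i j n
bounded≡rhs = <-rec _ step
  where
  step : ∀ n → (∀ {m} → m < n → ∀ k → 2 + m ≤ k → ∀ i j → bounded k i j m ≡ rhs i j m) →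
         ∀ k → 2 + n ≤ k → ∀ i j → bounded k i j n ≡ rhs i j n
  step n IH (suc (suc k)) (s≤s (s≤s n≤k)) zero    zero    =
    trans (bounded-00 (2 + k) (s≤s z≤n) n) (sym (rhs-00 n))
  step n IH (suc (suc k)) (s≤s (s≤s n≤k)) (suc i) j       = Agreement.agrees IH n≤k (suc i) j (s≤s z≤n)
  step n IH (suc (suc k)) (s≤s (s≤s n≤k)) zero    (suc j) = Agreement.agrees IH n≤k 0 (suc j) (s≤s z≤n)

-- Partitions with a new largest part

count : ∀ {A : Set} {P : A → Set} → Decidable P → List A → ℕ
count P? xs = length (filter P? xs)

module _ {A : Set} {P : A → Set} (P? : Decidable P) where

  count-++ : ∀ xs ys → count P? (xs ++ ys) ≡ count P? xs + count P? ys
  count-++ xs ys = trans (cong length (filter-++ P? xs ys)) (length-++ (filter P? xs))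

  count-concatMap : ∀ {B : Set} (f : B → List A) ks →
                    count P? (concatMap f ks) ≡ sumR (map (count P? ∘ f) ks)
  count-concatMap f []       = refl
  count-concatMap f (k ∷ ks) =
    trans (count-++ (f k) (concatMap f ks)) (cong (count P? (f k) +_) (count-concatMap f ks))

  count-none : ∀ {xs} → All (¬_ ∘ P) xs → count P? xs ≡ 0
  count-none ¬Ps = cong length (filter-none P? ¬Ps)

  count-map : ∀ {B : Set} (f : B → A) xs → count P? (map f xs) ≡ count (P? ∘ f) xs
  count-map f []       = refl
  count-map f (x ∷ xs) with does (P? (f x))
  ... | true  = cong suc (count-map f xs)
  ... | false = count-map f xs

count-cong-on : ∀ {A : Set} {P Q : A → Set} (P? : Decidable P) (Q? : Decidable Q) {xs} →
                All (λ x → P x ⇔ Q x) xs → count P? xs ≡ count Q? xs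
count-cong-on P? Q? {[]}     []           = refl
count-cong-on P? Q? {x ∷ xs} (P⇔Q ∷ rest) with P? x | Q? x
... | yes _  | yes _  = cong suc (count-cong-on P? Q? rest)
... | no _   | no _   = count-cong-on P? Q? rest
... | yes px | no ¬qx = ⊥-elim (¬qx (Equivalence.to P⇔Q px))
... | no ¬px | yes qx = ⊥-elim (¬px (Equivalence.from P⇔Q qx))

AtMostTwice : List ℕ → Set
AtMostTwice μ = All (λ a → mult a μ ≤ 2) μ

Separated : ℕ → ℕ → Set
Separated a b = (a ≡ b) ⊎ ((a + 2 ≤ b) ⊎ (b + 2 ≤ a))

Gapped : List ℕ → Set
Gapped μ = All (λ a → All (Separated a) μ) μ

mult-here : ∀ a μ → mult a (a ∷ μ) ≡ suc (mult a μ)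
mult-here a μ = cong length (filter-accept (a ≟_) refl)

mult-there : ∀ a x μ → a ≢ x → mult a (x ∷ μ) ≡ mult a μ
mult-there a x μ a≢x = cong length (filter-reject (a ≟_) a≢x)

deduplicate-repeat : ∀ M μ → deduplicate _≟_ (M ∷ M ∷ μ) ≡ deduplicate _≟_ (M ∷ μ)
deduplicate-repeat M μ = cong (M ∷_) (trans
  (filter-reject (¬? ∘ (M ≟_)) (λ M≢M → M≢M refl))
  (filter-idem (¬? ∘ (M ≟_)) (deduplicate _≟_ μ)))

repeated? : ∀ ν → Decidable (λ a → 2 ≤ mult a ν)
repeated? ν a = 2 ≤? mult a ν

count-repeated-cong : ∀ ν ν′ {xs} → All (λ a → mult a ν ≡ mult a ν′) xs →
                      count (repeated? ν) xs ≡ count (repeated? ν′) xs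
count-repeated-cong ν ν′ eqs = count-cong-on (repeated? ν) (repeated? ν′)
  (All.map (λ eq → mk⇔ (subst (2 ≤_) eq) (subst (2 ≤_) (sym eq))) eqs)

≤2-transfer : ∀ ν ν′ {μ} → All (λ a → mult a ν ≡ mult a ν′) μ →
              All (λ a → mult a ν ≤ 2) μ → All (λ a → mult a ν′ ≤ 2) μ
≤2-transfer ν ν′ eqs ≤2s = All.zipWith (λ (eq , ≤2) → subst (_≤ 2) eq ≤2) (eqs , ≤2s)

module _ {M : ℕ} {μ : List ℕ} (μ<M : All (_< M) μ) where

  mult-absent : mult M μ ≡ 0
  mult-absent = cong length (filter-none (M ≟_) (All.map >⇒≢ μ<M))

  mult-below : ∀ ν → All (λ a → mult a (M ∷ ν) ≡ mult a ν) μ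
  mult-below ν = All.map (λ {a} a<M → mult-there a M ν (<⇒≢ a<M)) μ<M

  deduplicate-fresh : deduplicate _≟_ (M ∷ μ) ≡ M ∷ deduplicate _≟_ μ
  deduplicate-fresh = cong (M ∷_) (filter-all (¬? ∘ (M ≟_)) (All.map >⇒≢ (deduplicate⁺ _≟_ μ<M)))

  private
    mult-once : mult M (M ∷ μ) ≡ 1
    mult-once = trans (mult-here M μ) (cong suc (mult-absent))

    mult-twice : mult M (M ∷ M ∷ μ) ≡ 2
    mult-twice = trans (mult-here M (M ∷ μ)) (cong suc mult-once)

    mult-below² : All (λ a → mult a (M ∷ M ∷ μ) ≡ mult a μ) μ
    mult-below² = All.zipWith (λ (e₁ , e₂) → trans e₁ e₂) (mult-below (M ∷ μ) , mult-below μ)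

    2≰1 : ¬ 2 ≤ 1
    2≰1 (s≤s ())

    dedup-below : All (λ a → mult a (M ∷ μ) ≡ mult a μ) (deduplicate _≟_ μ)
    dedup-below = deduplicate⁺ _≟_ (mult-below μ)

    dedup-below² : All (λ a → mult a (M ∷ M ∷ μ) ≡ mult a μ) (deduplicate _≟_ μ)
    dedup-below² = deduplicate⁺ _≟_ mult-below²

  ℓd-single : ℓd (M ∷ μ) ≡ suc (ℓd μ)
  ℓd-single = cong length (deduplicate-fresh)

  ℓd-double : ℓd (M ∷ M ∷ μ) ≡ suc (ℓd μ)
  ℓd-double = trans (cong length (deduplicate-repeat M μ)) ℓd-single

  ℓr-single : ℓr (M ∷ μ) ≡ ℓr μ
  ℓr-single = begin
    count (repeated? (M ∷ μ)) (deduplicate _≟_ (M ∷ μ))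
      ≡⟨ cong (count (repeated? (M ∷ μ))) (deduplicate-fresh) ⟩
    count (repeated? (M ∷ μ)) (M ∷ deduplicate _≟_ μ)
      ≡⟨ cong length (filter-reject (repeated? (M ∷ μ)) {M} {deduplicate _≟_ μ} (2≰1 ∘ subst (2 ≤_) mult-once)) ⟩
    count (repeated? (M ∷ μ)) (deduplicate _≟_ μ)
      ≡⟨ count-repeated-cong (M ∷ μ) μ dedup-below ⟩
    ℓr μ                                               ∎
    where open ≡-Reasoning

  ℓr-double : ℓr (M ∷ M ∷ μ) ≡ suc (ℓr μ)
  ℓr-double = begin
    count (repeated? (M ∷ M ∷ μ)) (deduplicate _≟_ (M ∷ M ∷ μ))
      ≡⟨ cong (count (repeated? (M ∷ M ∷ μ))) (trans (deduplicate-repeat M μ) (deduplicate-fresh)) ⟩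
    count (repeated? (M ∷ M ∷ μ)) (M ∷ deduplicate _≟_ μ)
      ≡⟨ cong length (filter-accept (repeated? (M ∷ M ∷ μ)) {M} {deduplicate _≟_ μ}
                                    (subst (2 ≤_) (sym mult-twice) ≤-refl)) ⟩
    suc (count (repeated? (M ∷ M ∷ μ)) (deduplicate _≟_ μ))
      ≡⟨ cong suc (count-repeated-cong (M ∷ M ∷ μ) μ dedup-below²) ⟩
    suc (ℓr μ) ∎
    where open ≡-Reasoning

  atMostTwice-single : AtMostTwice (M ∷ μ) ⇔ AtMostTwice μ
  atMostTwice-single = mk⇔
    (λ { (_ ∷ ≤2s) → ≤2-transfer (M ∷ μ) μ (mult-below μ) ≤2s })
    (λ ≤2s → subst (_≤ 2) (sym mult-once) (s≤s z≤n)
           ∷ ≤2-transfer μ (M ∷ μ) (All.map sym (mult-below μ)) ≤2s)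

  atMostTwice-double : AtMostTwice (M ∷ M ∷ μ) ⇔ AtMostTwice μ
  atMostTwice-double = mk⇔
    (λ { (_ ∷ _ ∷ ≤2s) → ≤2-transfer (M ∷ M ∷ μ) μ mult-below² ≤2s })
    (λ ≤2s → subst (_≤ 2) (sym mult-twice) ≤-refl ∷ subst (_≤ 2) (sym mult-twice) ≤-refl
           ∷ ≤2-transfer μ (M ∷ M ∷ μ) (All.map sym mult-below²) ≤2s)

¬atMostTwice-triple : ∀ M ρ → ¬ AtMostTwice (M ∷ M ∷ M ∷ ρ)
¬atMostTwice-triple M ρ (≤2 ∷ _) = 3≰2 (subst (_≤ 2) thrice ≤2)
  where
  thrice : mult M (M ∷ M ∷ M ∷ ρ) ≡ 3 + mult M ρ
  thrice = trans (mult-here M _) (cong suc (trans (mult-here M _) (cong suc (mult-here M ρ))))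
  3≰2 : ¬ 3 + mult M ρ ≤ 2
  3≰2 (s≤s (s≤s ()))

separated-sym : ∀ {a b} → Separated a b → Separated b a
separated-sym (inj₁ refl)        = inj₁ refl
separated-sym (inj₂ (inj₁ a+2≤b)) = inj₂ (inj₂ a+2≤b)
separated-sym (inj₂ (inj₂ b+2≤a)) = inj₂ (inj₁ b+2≤a)

separated-top : ∀ {m b} → b ≤ m → Separated (suc m) b ⇔ b < m
separated-top {m} {b} b≤m = mk⇔ to from
  where
  to : Separated (suc m) b → b < m
  to (inj₁ refl)        = ⊥-elim (<-irrefl refl (s≤s b≤m))
  to (inj₂ (inj₁ m+3≤b)) = ⊥-elim (<-irrefl refl (≤-trans (s≤s b≤m) (≤-trans (m≤m+n (suc m) 2) m+3≤b)))
  to (inj₂ (inj₂ b+2≤m+1)) = ≤-pred (subst (_≤ suc m) (+-comm b 2) b+2≤m+1)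
  from : b < m → Separated (suc m) b
  from b<m = inj₂ (inj₂ (subst (_≤ suc m) (+-comm 2 b) (s≤s b<m)))

gapped-∷ : ∀ x xs → Gapped (x ∷ xs) ⇔ (All (Separated x) xs × Gapped xs)
gapped-∷ x xs = mk⇔
  (λ { ((_ ∷ x-xs) ∷ xs-gapped) → x-xs , All.map (λ { (_ ∷ g) → g }) xs-gapped })
  (λ (x-xs , xs-gapped) → (inj₁ refl ∷ x-xs)
                        ∷ All.zipWith (λ (s , g) → separated-sym s ∷ g) (x-xs , xs-gapped))

gapped-repeat : ∀ x xs → Gapped (x ∷ x ∷ xs) ⇔ Gapped (x ∷ xs)
gapped-repeat x xs = mk⇔
  (proj₂ ∘ Equivalence.to (gapped-∷ x (x ∷ xs)))
  (λ g → Equivalence.from (gapped-∷ x (x ∷ xs))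
           ((inj₁ refl ∷ proj₁ (Equivalence.to (gapped-∷ x xs) g)) , g))

module _ {m : ℕ} {μ : List ℕ} (μ≤m : All (_≤ m) μ) where

  private
    μ<M : All (_< suc m) μ
    μ<M = All.map s≤s μ≤m

    open Equivalence

    gapped-top : Gapped (suc m ∷ μ) ⇔ (Gapped μ × All (_< m) μ)
    gapped-top = mk⇔
      (λ g → let (sep , g′) = to (gapped-∷ (suc m) μ) g in
             g′ , All.zipWith (λ (b≤m , s) → to (separated-top b≤m) s) (μ≤m , sep))
      (λ (g , μ<m) → from (gapped-∷ (suc m) μ)
             (All.zipWith (λ (b≤m , b<m) → from (separated-top b≤m) b<m) (μ≤m , μ<m) , g))

  InC-single : ∀ i j → InC (suc i) j (suc m ∷ μ) ⇔ (InC i j μ × All (_< m) μ)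
  InC-single i j = mk⇔
    (λ (len , twice , rep , gap) →
       (suc-injective len , to (atMostTwice-single μ<M) twice , trans (sym (ℓr-single μ<M)) rep ,
        proj₁ (to gapped-top gap)) , proj₂ (to gapped-top gap))
    (λ ((len , twice , rep , gap) , μ<m) →
       cong suc len , from (atMostTwice-single μ<M) twice , trans (ℓr-single μ<M) rep ,
       from gapped-top (gap , μ<m))

  InC-double : ∀ i j → InC i (suc j) (suc m ∷ suc m ∷ μ) ⇔ (InC i j μ × All (_< m) μ)
  InC-double i j = mk⇔
    (λ (len , twice , rep , gap) →
       (suc-injective (suc-injective (trans len (two-more i j))) , to (atMostTwice-double μ<M) twice ,
        suc-injective (trans (sym (ℓr-double μ<M)) rep) ,
        proj₁ (to gapped-top (to (gapped-repeat (suc m) μ) gap))) ,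
       proj₂ (to gapped-top (to (gapped-repeat (suc m) μ) gap)))
    (λ ((len , twice , rep , gap) , μ<m) →
       trans (cong (suc ∘ suc) len) (sym (two-more i j)) , from (atMostTwice-double μ<M) twice ,
       trans (ℓr-double μ<M) (cong suc rep) , from (gapped-repeat (suc m) μ) (from gapped-top (gap , μ<m)))
    where
    two-more : ∀ i j → i + 2 * suc j ≡ 2 + (i + 2 * j)
    two-more = solve-∀

  ¬InC-double-0 : ∀ i → ¬ InC i 0 (suc m ∷ suc m ∷ μ)
  ¬InC-double-0 i (_ , _ , rep , _) with () ← trans (sym (ℓr-double μ<M)) rep

  -- With i = 0 every part would have to be repeated, but suc m occurs once.
  ¬InC-single-0 : (AtMostTwice μ → ℓd μ + ℓr μ ≡ length μ) → ∀ j → ¬ InC 0 j (suc m ∷ μ)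
  ¬InC-single-0 split j (len , twice , rep , _) = <-irrefl refl (begin-strict
    length μ         <⟨ n<1+n (length μ) ⟩
    suc (length μ)   ≡⟨ len ⟩
    2 * j            ≡⟨ cong (2 *_) (sym ℓr≡j) ⟩
    2 * ℓr μ         ≡⟨ cong (ℓr μ +_) (+-identityʳ (ℓr μ)) ⟩
    ℓr μ + ℓr μ      ≤⟨ +-monoˡ-≤ (ℓr μ) (length-filter (repeated? μ) (deduplicate _≟_ μ)) ⟩
    ℓd μ + ℓr μ      ≡⟨ split (to (atMostTwice-single μ<M) twice) ⟩
    length μ         ∎)
    where
    open ≤-Reasoning
    ℓr≡j : ℓr μ ≡ j
    ℓr≡j = trans (sym (ℓr-single μ<M)) rep

-- InC fixes the number of parts and ℓr; this invariant of partitionsLE relates them to ℓd.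
record WellFormed (m : ℕ) (μ : List ℕ) : Set where
  field
    parts≤ : All (_≤ m) μ
    ℓd+ℓr≡length : AtMostTwice μ → ℓd μ + ℓr μ ≡ length μ

wellFormed-block : ∀ {m μ} → WellFormed m μ → ∀ k → WellFormed (suc m) (replicate k (suc m) ++ μ)
wellFormed-block {m} {μ} wf k = record
  { parts≤       = ++⁺ (replicate⁺ k ≤-refl) (All.map m≤n⇒m≤1+n parts≤)
  ; ℓd+ℓr≡length = split k
  }
  where
  open WellFormed wf
  open Equivalence
  μ<M : All (_< suc m) μ
  μ<M = All.map s≤s parts≤
  split : ∀ k → let ν = replicate k (suc m) ++ μ in AtMostTwice ν → ℓd ν + ℓr ν ≡ length ν
  split zero                = ℓd+ℓr≡length
  split (suc zero)          twice = trans (cong₂ _+_ (ℓd-single μ<M) (ℓr-single μ<M))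
    (cong suc (ℓd+ℓr≡length (to (atMostTwice-single μ<M) twice)))
  split (suc (suc zero))    twice = trans (cong₂ _+_ (ℓd-double μ<M) (ℓr-double μ<M))
    (cong suc (trans (+-suc (ℓd μ) (ℓr μ)) (cong suc (ℓd+ℓr≡length (to (atMostTwice-double μ<M) twice)))))
  split (suc (suc (suc k))) twice = ⊥-elim (¬atMostTwice-triple (suc m) (replicate k (suc m) ++ μ) twice)

partitionsLE-suc : ∀ n m → partitionsLE n (suc m) ≡
  concatMap (λ k → map (replicate k (suc m) ++_) (partitionsLE (n ∸ k * suc m) m))
            (filter (λ k → k * suc m ≤? n) (upTo (suc n)))
partitionsLE-suc zero    m = refl
partitionsLE-suc (suc n) m = refl

All-concatMap : ∀ {A B : Set} {P : B → Set} (f : A → List B) →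
                (∀ k → All P (f k)) → ∀ ks → All P (concatMap f ks)
All-concatMap f Pf ks = concat⁺ (map⁺ (All.universal Pf ks))

partitionsLE-wellFormed : ∀ n m → All (WellFormed m) (partitionsLE n m)
partitionsLE-wellFormed zero    zero    = record { parts≤ = [] ; ℓd+ℓr≡length = λ _ → refl } ∷ []
partitionsLE-wellFormed (suc n) zero    = []
partitionsLE-wellFormed n       (suc m) rewrite partitionsLE-suc n m =
  All-concatMap (λ k → map (replicate k (suc m) ++_) (partitionsLE (n ∸ k * suc m) m)) blocks
                (filter (λ k → k * suc m ≤? n) (upTo (suc n)))
  where
  blocks : ∀ k → All (WellFormed (suc m)) (map (replicate k (suc m) ++_) (partitionsLE (n ∸ k * suc m) m))
  blocks k = map⁺ (All.map (λ wf → wellFormed-block wf k) (partitionsLE-wellFormed (n ∸ k * suc m) m))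

ℓd-InC : ∀ {i j μ} → InC i j μ → (AtMostTwice μ → ℓd μ + ℓr μ ≡ length μ) → ℓd μ ≡ i + j
ℓd-InC {i} {j} {μ} (len , twice , rep , _) split = +-cancelʳ-≡ j (ℓd μ) (i + j) (begin
  ℓd μ + j     ≡⟨ cong (ℓd μ +_) rep ⟨
  ℓd μ + ℓr μ  ≡⟨ split twice ⟩
  length μ     ≡⟨ len ⟩
  i + 2 * j    ≡⟨ regroup i j ⟩
  i + j + j    ∎)
  where
  open ≡-Reasoning
  regroup : ∀ i j → i + 2 * j ≡ i + j + j
  regroup = solve-∀

-- Counting by the multiplicity of the largest part

sum-filter : ∀ {Q : ℕ → Set} (Q? : Decidable Q) (g : ℕ → ℕ) ks →
             sumR (map g (filter Q? ks)) ≡ sumR (map (λ k → if does (Q? k) then g k else 0) ks)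
sum-filter Q? g []       = refl
sum-filter Q? g (k ∷ ks) with does (Q? k)
... | true  = cong (g k +_) (sum-filter Q? g ks)
... | false = sum-filter Q? g ks

count-partitionsLE-suc : ∀ {P : List ℕ → Set} (P? : Decidable P) n m →
  count P? (partitionsLE n (suc m)) ≡
  sumR (map (λ k → shift (k * suc m) (λ x → count (P? ∘ (replicate k (suc m) ++_)) (partitionsLE x m)) n)
            (upTo (suc n)))
count-partitionsLE-suc P? n m = begin
  count P? (partitionsLE n (suc m))
    ≡⟨ cong (count P?) (partitionsLE-suc n m) ⟩
  count P? (concatMap blocks (filter fits (upTo (suc n))))
    ≡⟨ count-concatMap P? blocks (filter fits (upTo (suc n))) ⟩
  sumR (map (count P? ∘ blocks) (filter fits (upTo (suc n))))
    ≡⟨ sum-filter fits (count P? ∘ blocks) (upTo (suc n)) ⟩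
  sumR (map (λ k → if does (fits k) then count P? (blocks k) else 0) (upTo (suc n)))
    ≡⟨ cong sumR (map-cong (λ k → cong (λ c → if does (fits k) then c else 0)
                                       (count-map P? (replicate k (suc m) ++_) (partitionsLE (n ∸ k * suc m) m)))
                     (upTo (suc n))) ⟩
  sumR (map (λ k → shift (k * suc m) (λ x → count (P? ∘ (replicate k (suc m) ++_)) (partitionsLE x m)) n)
            (upTo (suc n))) ∎
  where
  open ≡-Reasoning
  blocks = λ k → map (replicate k (suc m) ++_) (partitionsLE (n ∸ k * suc m) m)
  fits = λ k → k * suc m ≤? n

sum-upTo-vanishing : ∀ h N d → (∀ k → N ≤ k → h k ≡ 0) →
                     sumR (map h (upTo (N + d))) ≡ sumR (map h (upTo N))
sum-upTo-vanishing h N zero    vanish = cong (λ t → sumR (map h (upTo t))) (+-identityʳ N)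
sum-upTo-vanishing h N (suc d) vanish = begin
  sumR (map h (upTo (N + suc d)))                ≡⟨ cong (λ t → sumR (map h (upTo t))) (+-suc N d) ⟩
  sumR (map h (upTo (suc (N + d))))              ≡⟨ cong (sumR ∘ map h) (upTo-∷ʳ (N + d)) ⟨
  sumR (map h (upTo (N + d) ∷ʳ (N + d)))         ≡⟨ cong sumR (map-++ h (upTo (N + d)) [ N + d ]) ⟩
  sumR (map h (upTo (N + d)) ++ [ h (N + d) ])   ≡⟨ sum-++ (map h (upTo (N + d))) [ h (N + d) ] ⟩
  sumR (map h (upTo (N + d))) + (h (N + d) + 0)
    ≡⟨ cong₂ _+_ (sum-upTo-vanishing h N d vanish) (cong (_+ 0) (vanish (N + d) (m≤m+n N d))) ⟩
  sumR (map h (upTo N)) + 0                      ≡⟨ +-identityʳ _ ⟩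
  sumR (map h (upTo N))                          ∎
  where open ≡-Reasoning

sum-upTo-truncate : ∀ h K n → (∀ k → K ≤ k → h k ≡ 0) → (∀ k → n < k → h k ≡ 0) →
                    sumR (map h (upTo (suc n))) ≡ sumR (map h (upTo K))
sum-upTo-truncate h K n beyond-K beyond-n = begin
  sumR (map h (upTo (suc n)))      ≡⟨ sum-upTo-vanishing h (suc n) K beyond-n ⟨
  sumR (map h (upTo (suc n + K)))  ≡⟨ cong (λ t → sumR (map h (upTo t))) (+-comm (suc n) K) ⟩
  sumR (map h (upTo (K + suc n)))  ≡⟨ sum-upTo-vanishing h K (suc n) beyond-K ⟩
  sumR (map h (upTo K))            ∎
  where open ≡-Reasoning

InC-after? : ∀ i j ν → Decidable (λ μ → InC i j (ν ++ μ))
InC-after? i j ν μ = InC? i j (ν ++ μ)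

InC-below? : ∀ i j m → Decidable (λ μ → InC i j μ × All (_< m) μ)
InC-below? i j m μ = InC? i j μ ×-dec all? (_<? m) μ

module _ (m x : ℕ) where

  open WellFormed

  count-once-0 : ∀ j → count (InC-after? 0 j [ suc m ]) (partitionsLE x m) ≡ 0
  count-once-0 j = count-none (InC-after? 0 j [ suc m ])
    (All.map (λ wf → ¬InC-single-0 (parts≤ wf) (ℓd+ℓr≡length wf) j) (partitionsLE-wellFormed x m))

  count-once : ∀ i j → count (InC-after? (suc i) j [ suc m ]) (partitionsLE x m)
                     ≡ count (InC-below? i j m) (partitionsLE x m)
  count-once i j = count-cong-on (InC-after? (suc i) j [ suc m ]) (InC-below? i j m)
    (All.map (λ wf → InC-single (parts≤ wf) i j) (partitionsLE-wellFormed x m))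

  count-twice-0 : ∀ i → count (InC-after? i 0 (suc m ∷ suc m ∷ [])) (partitionsLE x m) ≡ 0
  count-twice-0 i = count-none (InC-after? i 0 (suc m ∷ suc m ∷ []))
    (All.map (λ wf → ¬InC-double-0 (parts≤ wf) i) (partitionsLE-wellFormed x m))

  count-twice : ∀ i j → count (InC-after? i (suc j) (suc m ∷ suc m ∷ [])) (partitionsLE x m)
                      ≡ count (InC-below? i j m) (partitionsLE x m)
  count-twice i j = count-cong-on (InC-after? i (suc j) (suc m ∷ suc m ∷ [])) (InC-below? i j m)
    (All.map (λ wf → InC-double (parts≤ wf) i j) (partitionsLE-wellFormed x m))

  count-thrice : ∀ i j k → count (InC-after? i j (replicate (3 + k) (suc m))) (partitionsLE x m) ≡ 0
  count-thrice i j k = count-none (InC-after? i j (replicate (3 + k) (suc m))) (All.universal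
    (λ μ inC → ¬atMostTwice-triple (suc m) (replicate k (suc m) ++ μ) (proj₁ (proj₂ inC))) (partitionsLE x m))

  count-below-top : ∀ i j k →
    count (λ μ → InC-below? i j (suc m) (replicate (suc k) (suc m) ++ μ)) (partitionsLE x m) ≡ 0
  count-below-top i j k = count-none (λ μ → InC-below? i j (suc m) (replicate (suc k) (suc m) ++ μ))
    (All.universal (λ { μ (_ , (M<M ∷ _)) → <-irrefl refl M<M }) (partitionsLE x m))

  count-below-suc : ∀ i j → count (InC-below? i j (suc m)) (partitionsLE x m) ≡ count (InC? i j) (partitionsLE x m)
  count-below-suc i j = count-cong-on (InC-below? i j (suc m)) (InC? i j)
    (All.map (λ wf → mk⇔ proj₁ (_, All.map s≤s (parts≤ wf))) (partitionsLE-wellFormed x m))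

count-bounded : ∀ m n i j → count (InC? i j) (partitionsLE n m) ≡ bounded (2 + m) i j n
count-below : ∀ m x i j → count (InC-below? i j m) (partitionsLE x m) ≡ bounded (1 + m) i j x

count-bounded zero zero    zero    zero    = refl
count-bounded zero zero    zero    (suc j) = refl
count-bounded zero zero    (suc i) zero    = refl
count-bounded zero zero    (suc i) (suc j) = refl
count-bounded zero (suc n) zero    zero    = refl
count-bounded zero (suc n) zero    (suc j) = refl
count-bounded zero (suc n) (suc i) zero    = refl
count-bounded zero (suc n) (suc i) (suc j) = refl
count-bounded (suc m) n i j = begin
  count (InC? i j) (partitionsLE n M)  ≡⟨ count-partitionsLE-suc (InC? i j) n m ⟩
  sumR (map term (upTo (suc n)))       ≡⟨ sum-upTo-truncate term 3 n beyond-3 beyond-n ⟩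
  term 0 + (term 1 + (term 2 + 0))     ≡⟨ cong (λ t → term 0 + (term 1 + t)) (+-identityʳ (term 2)) ⟩
  term 0 + (term 1 + term 2)           ≡⟨ +-assoc (term 0) (term 1) (term 2) ⟨
  term 0 + term 1 + term 2             ≡⟨ +₃-cong (count-bounded m n i j) (single i) (pair j) ⟩
  bounded (3 + m) i j n                ∎
  where
  open ≡-Reasoning
  M = suc m
  copies : ℕ → ℕ → ℕ → ℕ → ℕ
  copies i j k x = count (InC-after? i j (replicate k M)) (partitionsLE x m)
  term : ℕ → ℕ
  term k = shift (k * M) (copies i j k) n

  beyond-3 : ∀ k → 3 ≤ k → term k ≡ 0
  beyond-3 (suc zero)          (s≤s ())
  beyond-3 (suc (suc zero))    (s≤s (s≤s ()))
  beyond-3 (suc (suc (suc k))) _ =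
    trans (shift-cong ((3 + k) * M) (λ x → count-thrice m x i j k) n) (shift-zero ((3 + k) * M) n)

  beyond-n : ∀ k → n < k → term k ≡ 0
  beyond-n k n<k = shift-< (k * M) (copies i j k) (<-≤-trans n<k (m≤m*n k M))

  single : ∀ i → shift (1 * M) (copies i j 1) n ≡ addSingle M (bounded (suc m)) i j n
  single zero    = trans (shift-cong (1 * M) (λ x → count-once-0 m x j) n) (shift-zero (1 * M) n)
  single (suc i) = trans (cong (λ N → shift N (copies (suc i) j 1) n) (*-identityˡ M))
                         (shift-cong M (λ x → trans (count-once m x i j) (count-below m x i j)) n)

  pair : ∀ j → shift (2 * M) (copies i j 2) n ≡ addPair M (bounded (suc m)) i j n
  pair zero    = trans (shift-cong (2 * M) (λ x → count-twice-0 m x i) n) (shift-zero (2 * M) n)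
  pair (suc j) = shift-cong (2 * M) (λ x → trans (count-twice m x i j) (count-below m x i j)) n

count-below zero zero    zero    zero    = refl
count-below zero zero    zero    (suc j) = refl
count-below zero zero    (suc i) j       = refl
count-below zero (suc x) zero    zero    = refl
count-below zero (suc x) zero    (suc j) = refl
count-below zero (suc x) (suc i) j       = refl
count-below (suc m) x i j = begin
  count (InC-below? i j (suc m)) (partitionsLE x (suc m))  ≡⟨ count-partitionsLE-suc (InC-below? i j (suc m)) x m ⟩
  sumR (map term (upTo (suc x)))                           ≡⟨ sum-upTo-truncate term 1 x beyond-0 beyond-x ⟩
  term 0 + 0                                               ≡⟨ +-identityʳ (term 0) ⟩
  count (InC-below? i j (suc m)) (partitionsLE x m)        ≡⟨ count-below-suc m x i j ⟩
  count (InC? i j) (partitionsLE x m)                      ≡⟨ count-bounded m x i j ⟩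
  bounded (2 + m) i j x                                    ∎
  where
  open ≡-Reasoning
  term : ℕ → ℕ
  term k = shift (k * suc m)
    (λ y → count (λ μ → InC-below? i j (suc m) (replicate k (suc m) ++ μ)) (partitionsLE y m)) x

  beyond-0 : ∀ k → 1 ≤ k → term k ≡ 0
  beyond-0 (suc k) _ =
    trans (shift-cong (suc k * suc m) (λ y → count-below-top m y i j k) x) (shift-zero (suc k * suc m) x)

  beyond-x : ∀ k → x < k → term k ≡ 0
  beyond-x k x<k = beyond-0 k (≤-trans (s≤s z≤n) x<k)

count≡rhs : ∀ i j n → count (InC? i j) (partitions n) ≡ rhs i j n
count≡rhs i j n = trans (count-bounded n n i j) (bounded≡rhs n (2 + n) ≤-refl i j)

-- From ℕ to an arbitrary commutative semiring

module Embedding {c ℓ : Level} (R : CommutativeSemiring c ℓ) where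

  open CommutativeSemiring R
    using (Carrier; _≈_; 1#; semiring; +-cong; *-cong)
    renaming (_*_ to _*ᴿ_; *-identityʳ to *ᴿ-identityʳ; refl to ≈-refl; sym to ≈-sym; trans to ≈-trans)
  open import Algebra.Properties.Semiring.Mult semiring
    using (×-homo-+; ×-homo-1; ×1-homo-*; ×-comm-*; ×-congʳ) renaming (_×_ to _·_)
  module R = Series R

  Embeds : R.PS → PS → Set ℓ
  Embeds F f = ∀ n → F n ≈ f n · 1#

  sum-embeds : ∀ (T : ℕ → Carrier) (t : ℕ → ℕ) → (∀ k → T k ≈ t k · 1#) →
               ∀ ks → R.sumR (map T ks) ≈ sumR (map t ks) · 1#
  sum-embeds T t T≈t []       = ≈-refl
  sum-embeds T t T≈t (k ∷ ks) =
    ≈-trans (+-cong (T≈t k) (sum-embeds T t T≈t ks)) (≈-sym (×-homo-+ 1# (t k) (sumR (map t ks))))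

  ⊛-embeds : ∀ F f G g → Embeds F f → Embeds G g → Embeds (F R.⊛ G) (f ⊛ g)
  ⊛-embeds F f G g F≈f G≈g n = sum-embeds (λ k → F k *ᴿ G (n ∸ k)) (λ k → f k * g (n ∸ k))
    (λ k → ≈-trans (*-cong (F≈f k) (G≈g (n ∸ k))) (≈-sym (×1-homo-* (f k) (g (n ∸ k))))) (upTo (suc n))

  shift-embeds : ∀ N F f → Embeds F f → Embeds (R.shift N F) (shift N f)
  shift-embeds N F f F≈f n with N ≤ᵇ n
  ... | true  = F≈f (n ∸ N)
  ... | false = ≈-refl

  one-embeds : Embeds R.one one
  one-embeds zero    = ≈-sym (×-homo-1 1#)
  one-embeds (suc n) = ≈-refl

  geom-embeds : ∀ k → Embeds (R.geom k) (geom k)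
  geom-embeds k n with does (k ∣? n)
  ... | true  = ≈-sym (×-homo-1 1#)
  ... | false = ≈-refl

  invQ-embeds : ∀ i → Embeds (R.invQ i) (invQ i)
  invQ-embeds zero    = one-embeds
  invQ-embeds (suc i) = ⊛-embeds _ (invQ i) _ (geom (suc i)) (invQ-embeds i) (geom-embeds (suc i))

  invQ2-embeds : ∀ j → Embeds (R.invQ2 j) (invQ2 j)
  invQ2-embeds zero    = one-embeds
  invQ2-embeds (suc j) = ⊛-embeds _ (invQ2 j) _ (geom (2 * suc j)) (invQ2-embeds j) (geom-embeds (2 * suc j))

  rhs-embeds : ∀ i j → Embeds (R.shift (minSize i j) (R.invQ i R.⊛ R.invQ2 j)) (rhs i j)
  rhs-embeds i j = shift-embeds (minSize i j) _ (invPoch i j)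
    (⊛-embeds _ (invQ i) _ (invQ2 j) (invQ-embeds i) (invQ2-embeds j))

  ·-as-* : ∀ n x → n · x ≈ x *ᴿ (n · 1#)
  ·-as-* n x = ≈-trans (×-congʳ n (≈-sym (*ᴿ-identityʳ x))) (≈-sym (×-comm-* n x 1#))

  sum-constant : ∀ {A : Set} (f : A → Carrier) {w} xs →
                 All (λ x → f x ≈ w) xs → R.sumR (map f xs) ≈ length xs · w
  sum-constant f []       []       = ≈-refl
  sum-constant f (x ∷ xs) (p ∷ ps) = +-cong p (sum-constant f xs ps)

  weight : Carrier → Carrier → List ℕ → Carrier
  weight u v λs = R.pow v (ℓr λs) *ᴿ R.pow u (ℓd λs)

  weight-InC : ∀ u v {i j m λs} → InC i j λs → WellFormed m λs → weight u v λs ≈ R.pow v j *ᴿ R.pow u (i + j)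
  weight-InC u v {i} inC@(_ , _ , rep , _) wf = CommutativeSemiring.reflexive R
    (cong₂ (λ r d → R.pow v r *ᴿ R.pow u d) rep (ℓd-InC {i} inC (WellFormed.ℓd+ℓr≡length wf)))

  weight-constant : ∀ u v i j n →
    All (λ λs → weight u v λs ≈ R.pow v j *ᴿ R.pow u (i + j)) (filter (InC? i j) (partitions n))
  weight-constant u v i j n = All.zipWith (λ (inC , wf) → weight-InC u v {i} inC wf)
    (all-filter (InC? i j) (partitions n) , filter⁺ (InC? i j) (partitionsLE-wellFormed n n))

lemma3p1 : ∀ {c ℓ : Level} (R : CommutativeSemiring c ℓ) (u v : CommutativeSemiring.Carrier R) (i j n : ℕ) →
    CommutativeSemiring._≈_ R (Series.genC R i j u v n) (Series.rhsC R i j u v n)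
lemma3p1 R u v i j n = begin
  genC i j u v n                       ≈⟨ sum-constant (weight u v) Cₙ (weight-constant u v i j n) ⟩
  count (InC? i j) (partitions n) · w  ≡⟨ cong (_· w) (count≡rhs i j n) ⟩
  rhs i j n · w                        ≈⟨ ·-as-* (rhs i j n) w ⟩
  w *ᴿ (rhs i j n · 1#)                ≈⟨ *-congˡ (rhs-embeds i j n) ⟨
  rhsC i j u v n                       ∎
  where
  open CommutativeSemiring R using (setoid; semiring; 1#; *-congˡ) renaming (_*_ to _*ᴿ_)
  open import Algebra.Properties.Semiring.Mult semiring using () renaming (_×_ to _·_)
  open Series R using (genC; rhsC; pow)
  open Embedding R
  open import Relation.Binary.Reasoning.Setoid setoid
  Cₙ = filter (InC? i j) (partitions n)
  w = pow v j *ᴿ pow u (i + j)
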